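{- Let $\ell'$ be an odd positive integer and let $k$ be an integer with $0<k<\phi^{\ell'}$. Then $(kF_{\ell'},kF_{\ell'+1})$ is a Hofstadter G pair, i.e. $G(kF_{\ell'+1})=kF_{\ell'}$.
   Context: $F_0=0$, $F_1=1$, $F_i=F_{i-1}+F_{i-2}$ are the Fibonacci numbers and $\phi=(1+\sqrt5)/2$. Hofstadter's G function is $G(x)=\lfloor\phi^{ -1}(x+1)\rfloor$ for integers $x\ge0$ (equivalently $G(0)=0$, $G(1)=1$, $G(x)=x-G(G(x-1))$). A Hofstadter G pair is a pair $(u,v)$ of positive integers with $u=G(v)$. -}

module Defs where

open import Data.Nat using (ℕ; zero; suc; _+_; _*_; _∸_; _^_; _<_)
open import Data.Nat.DivMod using (_/_)
open import Data.Product using (_×_; _,_; proj₁; proj₂)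
open import Data.Sum using (_⊎_)

fib : ℕ → ℕ
fib zero = 0
fib (suc zero) = 1
fib (suc (suc n)) = fib (suc n) + fib n

-- Invariant: gFuel f x is the true G(x) whenever x < f (all recursive
-- calls stay below the fuel since G(y) ≤ y).
gFuel : ℕ → ℕ → ℕ
gFuel zero _ = 0
gFuel (suc f) zero = 0
gFuel (suc f) (suc x) = suc x ∸ gFuel f (gFuel f x)

G : ℕ → ℕ
G x = gFuel (suc x) x

-- φ^n represented exactly as (a , b) meaning (a + b√5)/2, computed by
-- repeated multiplication by φ = (1 + √5)/2:
--   (a + b√5)/2 · (1 + √5)/2 = ((a + 5b)/2 + ((a + b)/2)√5)/2
-- (a + b is always even here, so the divisions are exact).
phiPow : ℕ → ℕ × ℕ
phiPow zero = 2 , 0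
phiPow (suc n) = ((a + 5 * b) / 2) , ((a + b) / 2)
  where
    a = proj₁ (phiPow n)
    b = proj₂ (phiPow n)

-- k < (a + b√5)/2  ⇔  2k < a + b√5  ⇔  2k < a, or (2k ≥ a and (2k - a)² < 5b²)
-- (if 2k < a the first disjunct holds; otherwise 2k ∸ a is the true difference)
_<halfSqrt5_ : ℕ → ℕ × ℕ → Set
k <halfSqrt5 (a , b) = (2 * k < a) ⊎ ((2 * k ∸ a) ^ 2 < 5 * b ^ 2)

_<φ^_ : ℕ → ℕ → Set
k <φ^ n = k <halfSqrt5 phiPow n

{-# OPTIONS --safe #-}
module Submission where

-- G(x) = ⌊(x + 1)/φ⌋ means gφ < x + 1 < (g + 1)φ for g = G(x), and by induction on x this
-- interval characterisation is preserved by the recursion G(n) = n − G(G(n − 1)); the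
-- inequalities are handled in ℤ[φ] = {p + qφ}. For odd ℓ the conjugate ψ = 1 − φ satisfies
-- ψ^ℓ = F(ℓ+1) − F(ℓ)φ = −φ^(−ℓ), so for g = kF(ℓ) and x = kF(ℓ+1) the two inequalities
-- read 1 + kψ^ℓ > 0 and φ⁻¹ − kψ^ℓ > 0. Multiplied by φ^ℓ they become φ^ℓ − k > 0, which is
-- the hypothesis, and φ^(ℓ−1) + k > 0. The hypothesis, stated with √5, first yields k ≤ L(ℓ)
-- for the Lucas number L(ℓ) = φ^ℓ + ψ^ℓ (as L(ℓ)² + 4 = 5F(ℓ)²), and then
-- φ^ℓ − k = (L(ℓ) − k) + φ^(−ℓ).

open import Defs
open import Data.Nat.Base using (ℕ; zero; suc)
open import Data.Product.Base using (_×_; _,_)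
open import Relation.Nullary.Negation.Core using (¬_)
open import Relation.Binary.PropositionalEquality
  using (_≡_; refl; sym; trans; cong; cong₂; subst; subst₂; module ≡-Reasoning)

module LucasNumbers where

  open import Data.Nat.Base using (_+_; _*_; _^_; _∸_; _≤_; _<_)
  open import Data.Nat.Properties
    using (≮⇒≥; <⇒≱; <⇒≤; ≤-trans; m≤m+n; m≤n*m; *-monoʳ-≤; ^-monoˡ-≤; m+n≤o⇒m≤o∸n;
           +-cancelʳ-≡; *-identityʳ; *-suc; module ≤-Reasoning)
  open import Data.Nat.DivMod using (_/_; m*n/n≡m)
  open import Data.Nat.Tactic.RingSolver using (solve-∀)
  open import Data.Sum.Base using (inj₁; inj₂)

  data Even : ℕ → Set where
    even-0 : Even 0
    even-+2 : ∀ {n} → Even n → Even (2 + n)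

  even-2* : ∀ m → Even (2 * m)
  even-2* zero = even-0
  even-2* (suc m) = subst Even (sym (*-suc 2 m)) (even-+2 (even-2* m))

  lucas : ℕ → ℕ
  lucas zero = 2
  lucas (suc n) = fib (suc (suc n)) + fib n

  lucas+fib : ∀ n → lucas n + fib n ≡ fib (suc n) * 2
  lucas+fib zero = refl
  lucas+fib (suc n) = identity (fib (suc n)) (fib n)
    where
    identity : ∀ a b → a + b + b + a ≡ (a + b) * 2
    identity = solve-∀

  lucas+5fib : ∀ n → lucas n + 5 * fib n ≡ lucas (suc n) * 2
  lucas+5fib zero = refl
  lucas+5fib (suc n) = identity (fib (suc n)) (fib n)
    where
    identity : ∀ a b → a + b + b + 5 * a ≡ (a + b + a + a) * 2
    identity = solve-∀

  phiPow≡lucas,fib : ∀ n → phiPow n ≡ (lucas n , fib n)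
  phiPow≡lucas,fib zero = refl
  phiPow≡lucas,fib (suc n) = cong₂ _,_
    (trans (cong (λ (a , b) → (a + 5 * b) / 2) (phiPow≡lucas,fib n)) (half (lucas+5fib n)))
    (trans (cong (λ (a , b) → (a + b) / 2) (phiPow≡lucas,fib n)) (half (lucas+fib n)))
    where
    half : ∀ {m n} → m ≡ n * 2 → m / 2 ≡ n
    half {n = n} refl = m*n/n≡m n 2

  -- L² − 5F² = 4(−1)ⁿ, the norm of φⁿ = (L + F√5)/2, here for odd n = suc j
  lucas-norm : ∀ {j} → Even j → 5 * (fib (suc j) * fib (suc j)) ≡ lucas (suc j) * lucas (suc j) + 4
  lucas-norm even-0 = refl
  lucas-norm (even-+2 {j} even) = two-steps (fib (suc j)) (fib j) (lucas-norm even)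
    where
    -- with a = F(j+1) and b = F(j) these are the unfolded L(j+1), F(j+3), L(j+3);
    -- 5F′² − L′² = 5a² − L² holds identically
    two-steps : ∀ a b → let L = a + b + b
                            F′ = a + b + a
                            L′ = F′ + (a + b) + (a + b)
                        in 5 * (a * a) ≡ L * L + 4 → 5 * (F′ * F′) ≡ L′ * L′ + 4
    two-steps a b norm =
      +-cancelʳ-≡ (5 * (a * a)) _ _ (trans (cong (5 * ((a + b + a) * (a + b + a)) +_) norm) (identity a b))
      where
      identity : ∀ a b → let L = a + b + b
                             F′ = a + b + a
                             L′ = F′ + (a + b) + (a + b)
                         in 5 * (F′ * F′) + (L * L + 4) ≡ L′ * L′ + 4 + 5 * (a * a)
      identity = solve-∀

  <halfSqrt5⇒≤ : ∀ {k a b} → 5 * b ^ 2 ≤ (a + 2) ^ 2 → k <halfSqrt5 (a , b) → k ≤ a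
  <halfSqrt5⇒≤ {k} {a} _ (inj₁ 2k<a) =
    ≮⇒≥ λ a<k → <⇒≱ 2k<a (≤-trans (<⇒≤ a<k) (m≤n*m k 2))
  <halfSqrt5⇒≤ {k} {a} 5b²≤[a+2]² (inj₂ [2k∸a]²<5b²) =
    ≮⇒≥ λ a<k → <⇒≱ [2k∸a]²<5b² (≤-trans 5b²≤[a+2]² (^-monoˡ-≤ 2 (a+2≤2k∸a a<k)))
    where
    a+2≤2k∸a : a < k → a + 2 ≤ 2 * k ∸ a
    a+2≤2k∸a a<k = m+n≤o⇒m≤o∸n (a + 2) (subst (_≤ 2 * k) (identity a) (*-monoʳ-≤ 2 a<k))
      where
      identity : ∀ a → 2 * (1 + a) ≡ a + 2 + a
      identity = solve-∀

  <φ^⇒≤lucas : ∀ {j k} → Even j → k <φ^ suc j → k ≤ lucas (suc j)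
  <φ^⇒≤lucas {j} {k} even k<φ^ℓ =
    <halfSqrt5⇒≤ {k} {L} {F} 5F²≤[L+2]² (subst (k <halfSqrt5_) (phiPow≡lucas,fib (suc j)) k<φ^ℓ)
    where
    F = fib (suc j)
    L = lucas (suc j)
    square : ∀ x → x ^ 2 ≡ x * x
    square x = cong (x *_) (*-identityʳ x)
    open ≤-Reasoning
    5F²≤[L+2]² : 5 * F ^ 2 ≤ (L + 2) ^ 2
    5F²≤[L+2]² = begin
      5 * F ^ 2             ≡⟨ cong (5 *_) (square F) ⟩
      5 * (F * F)           ≡⟨ lucas-norm even ⟩
      L * L + 4             ≤⟨ m≤m+n (L * L + 4) (4 * L) ⟩
      L * L + 4 + 4 * L     ≡⟨ identity L ⟩
      (L + 2) * (L + 2)     ≡⟨ square (L + 2) ⟨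
      (L + 2) ^ 2           ∎
      where
      identity : ∀ L → L * L + 4 + 4 * L ≡ (L + 2) * (L + 2)
      identity = solve-∀

open LucasNumbers using (Even; even-0; even-+2; even-2*; lucas; <φ^⇒≤lucas)

module GoldenIntegers where

  open import Data.Nat.Base as ℕ using (z≤n; s≤s)
  import Data.Nat.Properties as ℕ
  open import Data.Integer.Base using (ℤ; +_; 0ℤ; 1ℤ; -1ℤ; _+_; _*_; -_; _-_; _≤_; _<_; +≤+; +<+)
  open import Data.Integer.Properties
    using (≤-refl; <⇒≤; ≤-antisym; ≮⇒≥; ≰⇒>; <-irrefl; +-mono-≤; +-mono-≤-<; +-mono-<-≤; i≤j⇒0≤j-i; i<j⇒suc[i]≤j;
           +-injective; drop‿+<+; m-n≡m⊖n; ⊖-≥; pos-*)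
  open import Data.Integer.Tactic.RingSolver using (solve)
  open import Data.List.Base using (_∷_; [])

  -- p +φ q stands for p + qφ
  infix 5.5 _+φ_
  data ℤ[φ] : Set where
    _+φ_ : ℤ → ℤ → ℤ[φ]

  ι : ℤ → ℤ[φ]
  ι n = n +φ 0ℤ

  φ⁻¹ : ℤ[φ]
  φ⁻¹ = -1ℤ +φ 1ℤ

  infixl 5 _⊕_
  _⊕_ : ℤ[φ] → ℤ[φ] → ℤ[φ]
  (p +φ q) ⊕ (r +φ s) = p + r +φ q + s

  infixr 7 _·_
  _·_ : ℤ → ℤ[φ] → ℤ[φ]
  c · (p +φ q) = c * p +φ c * q

  -- (p + qφ)φ = q + (p + q)φ as φ² = 1 + φ
  φ*_ : ℤ[φ] → ℤ[φ]
  φ* (p +φ q) = q +φ p + q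

  φ^_*_ : ℕ → ℤ[φ] → ℤ[φ]
  φ^ zero * u = u
  φ^ suc n * u = φ* (φ^ n * u)

  φ*-⊕ : ∀ u v → φ* (u ⊕ v) ≡ φ* u ⊕ φ* v
  φ*-⊕ (p +φ q) (r +φ s) = cong (q + s +φ_) (solve (p ∷ q ∷ r ∷ s ∷ []))

  φ*-· : ∀ c u → φ* (c · u) ≡ c · φ* u
  φ*-· c (p +φ q) = cong (c * q +φ_) (solve (c ∷ p ∷ q ∷ []))

  φ^-⊕ : ∀ n u v → φ^ n * (u ⊕ v) ≡ φ^ n * u ⊕ φ^ n * v
  φ^-⊕ zero u v = refl
  φ^-⊕ (suc n) u v = trans (cong φ*_ (φ^-⊕ n u v)) (φ*-⊕ (φ^ n * u) (φ^ n * v))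

  φ^-· : ∀ n c u → φ^ n * (c · u) ≡ c · (φ^ n * u)
  φ^-· zero c u = refl
  φ^-· (suc n) c u = trans (cong φ*_ (φ^-· n c u)) (φ*-· c (φ^ n * u))

  φ^-φ* : ∀ n u → φ^ n * (φ* u) ≡ φ* (φ^ n * u)
  φ^-φ* zero u = refl
  φ^-φ* (suc n) u = cong φ*_ (φ^-φ* n u)

  φ^-0 : ∀ n → φ^ n * ι 0ℤ ≡ ι 0ℤ
  φ^-0 zero = refl
  φ^-0 (suc n) = cong φ*_ (φ^-0 n)

  data Nonneg : ℤ[φ] → Set where
    nonneg : ∀ {p q} → 0ℤ ≤ p → 0ℤ ≤ q → Nonneg (p +φ q)

  data Nonneg⁺ : ℤ[φ] → Set where
    nonneg⁺ : ∀ {p q} → 0ℤ ≤ p → 0ℤ < q → Nonneg⁺ (p +φ q)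

  Nonneg-φ* : ∀ {u} → Nonneg u → Nonneg (φ* u)
  Nonneg-φ* (nonneg 0≤p 0≤q) = nonneg 0≤q (+-mono-≤ 0≤p 0≤q)

  Nonneg⁺-φ* : ∀ {u} → Nonneg⁺ u → Nonneg⁺ (φ* u)
  Nonneg⁺-φ* (nonneg⁺ 0≤p 0<q) = nonneg⁺ (<⇒≤ 0<q) (+-mono-≤-< 0≤p 0<q)

  Nonneg-φ^ : ∀ n {u} → Nonneg u → Nonneg (φ^ n * u)
  Nonneg-φ^ zero u≥0 = u≥0
  Nonneg-φ^ (suc n) u≥0 = Nonneg-φ* (Nonneg-φ^ n u≥0)

  Nonneg⁺-⊕ : ∀ {u v} → Nonneg⁺ u → Nonneg v → Nonneg⁺ (u ⊕ v)
  Nonneg⁺-⊕ (nonneg⁺ 0≤p 0<q) (nonneg 0≤r 0≤s) = nonneg⁺ (+-mono-≤ 0≤p 0≤r) (+-mono-<-≤ 0<q 0≤s)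

  Nonneg⁺⇒Nonneg : ∀ {u} → Nonneg⁺ u → Nonneg u
  Nonneg⁺⇒Nonneg (nonneg⁺ 0≤p 0<q) = nonneg 0≤p (<⇒≤ 0<q)

  -- p + qφ > 0 iff some φⁿ(p + qφ) has coordinates p′ ≥ 0 and q′ > 0: a constructive positivity predicate
  record Positive (u : ℤ[φ]) : Set where
    constructor positive
    field
      power : ℕ
      nonneg⁺-at-power : Nonneg⁺ (φ^ power * u)

  Positive-resp : ∀ {p q p′ q′} → Positive (p +φ q) → p ≡ p′ → q ≡ q′ → Positive (p′ +φ q′)
  Positive-resp pos refl refl = pos

  ¬Positive-0 : ¬ Positive (ι 0ℤ)
  ¬Positive-0 (positive n u>0) with subst Nonneg⁺ (φ^-0 n) u>0
  ... | nonneg⁺ _ 0<0 = <-irrefl refl 0<0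

  Positive-1 : Positive (ι 1ℤ)
  Positive-1 = positive 1 (nonneg⁺ ≤-refl (+<+ (s≤s z≤n)))

  Positive-φ⁻¹ : Positive φ⁻¹
  Positive-φ⁻¹ = positive 2 (nonneg⁺ ≤-refl (+<+ (s≤s z≤n)))

  Positive-⊕-Nonneg : ∀ {u v} → Positive u → Nonneg v → Positive (u ⊕ v)
  Positive-⊕-Nonneg {u} {v} (positive n φⁿu>0) v≥0 =
    positive n (subst Nonneg⁺ (sym (φ^-⊕ n u v)) (Nonneg⁺-⊕ φⁿu>0 (Nonneg-φ^ n v≥0)))

  Positive-φ* : ∀ {u} → Positive u → Positive (φ* u)
  Positive-φ* {u} (positive n φⁿu>0) = positive n (subst Nonneg⁺ (sym (φ^-φ* n u)) (Nonneg⁺-φ* φⁿu>0))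

  Positive-φ*⁻ : ∀ {u} → Positive (φ* u) → Positive u
  Positive-φ*⁻ {u} (positive n φⁿφu>0) = positive (suc n) (subst Nonneg⁺ (φ^-φ* n u) φⁿφu>0)

  Positive-φ^ : ∀ n {u} → Positive u → Positive (φ^ n * u)
  Positive-φ^ zero pos = pos
  Positive-φ^ (suc n) pos = Positive-φ* (Positive-φ^ n pos)

  Positive-φ^⁻ : ∀ n {u} → Positive (φ^ n * u) → Positive u
  Positive-φ^⁻ zero pos = pos
  Positive-φ^⁻ (suc n) pos = Positive-φ^⁻ n (Positive-φ*⁻ pos)

  Positive-⊕ : ∀ {u v} → Positive u → Positive v → Positive (u ⊕ v)
  Positive-⊕ {u} {v} u>0 (positive n φⁿv>0) = Positive-φ^⁻ n (subst Positive (sym (φ^-⊕ n u v))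
    (Positive-⊕-Nonneg (Positive-φ^ n u>0) (Nonneg⁺⇒Nonneg φⁿv>0)))

  i<j⇒0≤j-[1+i] : ∀ {i j} → i < j → 0ℤ ≤ j - (1ℤ + i)
  i<j⇒0≤j-[1+i] i<j = i≤j⇒0≤j-i (i<j⇒suc[i]≤j i<j)

  -- gφ < n < (1 + g)φ, i.e. g = ⌊n/φ⌋ (φ being irrational)
  infix 4 _≡⌊_/φ⌋
  _≡⌊_/φ⌋ : ℤ → ℤ → Set
  g ≡⌊ n /φ⌋ = Positive (n +φ - g) × Positive (- n +φ 1ℤ + g)

  ⌊/φ⌋-unique : ∀ {n g g′} → g ≡⌊ n /φ⌋ → g′ ≡⌊ n /φ⌋ → g ≡ g′
  ⌊/φ⌋-unique g-floor g′-floor = ≤-antisym (≤-floor g-floor g′-floor) (≤-floor g′-floor g-floor)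
    where
    -- n < (1 + g′)φ ≤ gφ < n
    ≤-floor : ∀ {n g g′} → g ≡⌊ n /φ⌋ → g′ ≡⌊ n /φ⌋ → g ≤ g′
    ≤-floor {n} {g} {g′} (gφ<n , _) (_ , n<[1+g′]φ) = ≮⇒≥ {g′} {g} λ g′<g → ¬Positive-0 (Positive-resp
      (Positive-⊕-Nonneg (Positive-⊕ n<[1+g′]φ gφ<n) (nonneg ≤-refl (i<j⇒0≤j-[1+i] g′<g)))
      (solve (n ∷ g ∷ g′ ∷ [])) (solve (n ∷ g ∷ g′ ∷ [])))

  -- gφ < n ≤ g would give g < 0
  ⌊/φ⌋-< : ∀ {n g} → 0ℤ ≤ g → g ≡⌊ n /φ⌋ → g < n
  ⌊/φ⌋-< {n} {g} 0≤g (gφ<n , _) = ≰⇒> {n} {g} λ n≤g → ¬Positive-0 (Positive-resp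
    (Positive-⊕-Nonneg (Positive-φ* (Positive-⊕-Nonneg gφ<n (nonneg (i≤j⇒0≤j-i n≤g) ≤-refl))) (nonneg 0≤g ≤-refl))
    (solve (n ∷ g ∷ [])) (solve (n ∷ g ∷ [])))

  -- G(n) = n − G(G(n − 1)) for G(n) = ⌊(n + 1)/φ⌋, with a = G(n − 1) and b = G(a)
  ⌊/φ⌋-recurrence : ∀ {n a b} → a ≡⌊ n /φ⌋ → b ≡⌊ 1ℤ + a /φ⌋ → n - b ≡⌊ 1ℤ + n /φ⌋
  ⌊/φ⌋-recurrence {n} {a} {b} (aφ<n , n<[1+a]φ) (bφ<1+a , 1+a<[1+b]φ) = lower , upper
    where
    -- otherwise aφ < n ≤ a + b − 1, which multiplied by φ and added to bφ < 1 + a gives φ < 1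
    a≤n-b : a ≤ n - b
    a≤n-b = ≮⇒≥ {n - b} {a} λ n-b<a → ¬Positive-0 (Positive-resp
      (Positive-⊕ (Positive-⊕ (Positive-φ* (Positive-⊕-Nonneg aφ<n (nonneg (i<j⇒0≤j-[1+i] n-b<a) ≤-refl))) bφ<1+a)
                  Positive-φ⁻¹)
      (solve (n ∷ a ∷ b ∷ [])) (solve (n ∷ a ∷ b ∷ [])))
    -- otherwise a + b + 2 ≤ n < (1 + a)φ, which multiplied by φ contradicts 1 + a < (1 + b)φ
    n-b≤1+a : n - b ≤ 1ℤ + a
    n-b≤1+a = ≮⇒≥ {1ℤ + a} {n - b} λ 1+a<n-b → ¬Positive-0 (Positive-resp
      (Positive-⊕ (Positive-φ* (Positive-⊕-Nonneg n<[1+a]φ (nonneg (i<j⇒0≤j-[1+i] 1+a<n-b) ≤-refl))) 1+a<[1+b]φ)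
      (solve (n ∷ a ∷ b ∷ [])) (solve (n ∷ a ∷ b ∷ [])))
    -- φ(1 + n − (n − b)φ) = (1 + b)φ − (n − b) ≥ (1 + b)φ − (1 + a) > 0
    lower : Positive (1ℤ + n +φ - (n - b))
    lower = Positive-φ*⁻ (Positive-resp (Positive-⊕-Nonneg 1+a<[1+b]φ (nonneg (i≤j⇒0≤j-i n-b≤1+a) ≤-refl))
      (solve (n ∷ a ∷ b ∷ [])) (solve (n ∷ a ∷ b ∷ [])))
    -- φ((1 + n − b)φ − (1 + n)) = (1 + n − b) − bφ ≥ (1 + a) − bφ > 0
    upper : Positive (- (1ℤ + n) +φ 1ℤ + (n - b))
    upper = Positive-φ*⁻ (Positive-resp (Positive-⊕-Nonneg bφ<1+a (nonneg (i≤j⇒0≤j-i a≤n-b) ≤-refl))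
      (solve (n ∷ a ∷ b ∷ [])) (solve (n ∷ a ∷ b ∷ [])))

  ⌊/φ⌋-≤ : ∀ {g x} → + g ≡⌊ + suc x /φ⌋ → g ℕ.≤ x
  ⌊/φ⌋-≤ g-floor = ℕ.s≤s⁻¹ (drop‿+<+ (⌊/φ⌋-< (+≤+ z≤n) g-floor))

  gFuel-⌊/φ⌋ : ∀ f {x} → x ℕ.< f → + gFuel f x ≡⌊ + suc x /φ⌋
  gFuel-⌊/φ⌋ (suc f) {zero} _ = Positive-1 , Positive-φ⁻¹
  gFuel-⌊/φ⌋ (suc f) {suc x} (s≤s x<f) =
    subst (_≡⌊ + suc (suc x) /φ⌋) (trans (m-n≡m⊖n (suc x) b) (⊖-≥ b≤1+x)) (⌊/φ⌋-recurrence a-floor b-floor)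
    where
    a = gFuel f x
    b = gFuel f a
    a-floor : + a ≡⌊ + suc x /φ⌋
    a-floor = gFuel-⌊/φ⌋ f x<f
    a≤x : a ℕ.≤ x
    a≤x = ⌊/φ⌋-≤ a-floor
    b-floor : + b ≡⌊ + suc a /φ⌋
    b-floor = gFuel-⌊/φ⌋ f (ℕ.≤-<-trans a≤x x<f)
    b≤1+x : b ℕ.≤ suc x
    b≤1+x = ℕ.≤-trans (⌊/φ⌋-≤ b-floor) (ℕ.≤-trans a≤x (ℕ.n≤1+n x))

  ⌊/φ⌋⇒G≡ : ∀ {g x} → + g ≡⌊ + suc x /φ⌋ → G x ≡ g
  ⌊/φ⌋⇒G≡ {x = x} g-floor = +-injective (⌊/φ⌋-unique (gFuel-⌊/φ⌋ (suc x) (ℕ.n<1+n x)) g-floor)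

  ⌊/φ⌋-intro : ∀ {K F₁ F₂} → Positive (ι 1ℤ ⊕ K · (F₂ +φ - F₁)) → Positive (φ⁻¹ ⊕ - K · (F₂ +φ - F₁)) →
               K * F₁ ≡⌊ 1ℤ + K * F₂ /φ⌋
  ⌊/φ⌋-intro {K} {F₁} {F₂} lower upper =
    Positive-resp lower refl (solve (K ∷ F₁ ∷ F₂ ∷ [])) ,
    Positive-resp upper (solve (K ∷ F₁ ∷ F₂ ∷ [])) (solve (K ∷ F₁ ∷ F₂ ∷ []))

  -- ψⁿ for the conjugate ψ = 1 − φ = −φ⁻¹ of φ; the lemmas below are about odd ℓ = suc j
  ψ^_ : ℕ → ℤ[φ]
  ψ^ n = + fib (suc n) +φ - + fib n

  φ*φ*ψ^[2+n] : ∀ n → φ* φ* ψ^ suc (suc n) ≡ ψ^ n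
  φ*φ*ψ^[2+n] n = identity (+ fib (suc n)) (+ fib n)
    where
    identity : ∀ x y → φ* φ* (x + y + x +φ - (x + y)) ≡ x +φ - y
    identity x y = cong₂ _+φ_ (solve (x ∷ y ∷ [])) (solve (x ∷ y ∷ []))

  φ^*1≡fib : ∀ j → φ^ suc j * ι 1ℤ ≡ + fib j +φ + fib (suc j)
  φ^*1≡fib zero = refl
  φ^*1≡fib (suc j) =
    trans (cong φ*_ (φ^*1≡fib j)) (cong (λ m → + fib (suc j) +φ + m) (ℕ.+-comm (fib j) (fib (suc j))))

  φ^ℓ*ψ^ℓ : ∀ {j} → Even j → φ^ suc j * ψ^ suc j ≡ ι -1ℤ
  φ^ℓ*ψ^ℓ even-0 = refl
  φ^ℓ*ψ^ℓ (even-+2 {j} even) = begin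
    φ* φ* (φ^ suc j * ψ^ suc (suc (suc j)))  ≡⟨ cong φ*_ (φ^-φ* (suc j) _) ⟨
    φ* (φ^ suc j * φ* ψ^ suc (suc (suc j)))  ≡⟨ φ^-φ* (suc j) _ ⟨
    φ^ suc j * φ* φ* ψ^ suc (suc (suc j))    ≡⟨ cong (φ^ suc j *_) (φ*φ*ψ^[2+n] (suc j)) ⟩
    φ^ suc j * ψ^ suc j                      ≡⟨ φ^ℓ*ψ^ℓ even ⟩
    ι -1ℤ                                    ∎
    where open ≡-Reasoning

  Positive-−ψ^ℓ : ∀ {j} → Even j → Positive (-1ℤ · ψ^ suc j)
  Positive-−ψ^ℓ {j} even = Positive-φ^⁻ (suc j) (subst Positive φ^ℓ*−ψ^ℓ≡1 Positive-1)
    where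
    φ^ℓ*−ψ^ℓ≡1 : ι 1ℤ ≡ φ^ suc j * (-1ℤ · ψ^ suc j)
    φ^ℓ*−ψ^ℓ≡1 = sym (trans (φ^-· (suc j) -1ℤ (ψ^ suc j)) (cong (-1ℤ ·_) (φ^ℓ*ψ^ℓ even)))

  Positive-1+kψ^ℓ : ∀ {j k} → Even j → k ℕ.≤ lucas (suc j) → Positive (ι 1ℤ ⊕ + k · ψ^ suc j)
  Positive-1+kψ^ℓ {j} {k} even k≤L = Positive-φ^⁻ (suc j) (subst Positive (sym φ^ℓ[1+kψ^ℓ])
    (Positive-⊕-Nonneg (Positive-−ψ^ℓ even) (nonneg (i≤j⇒0≤j-i (+≤+ k≤L)) ≤-refl)))
    where
    rearrange : ∀ F₀ F₁ F₂ K → (F₀ +φ F₁) ⊕ K · ι -1ℤ ≡ -1ℤ · (F₂ +φ - F₁) ⊕ ι (F₂ + F₀ - K)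
    rearrange F₀ F₁ F₂ K = cong₂ _+φ_ (solve (F₀ ∷ F₁ ∷ F₂ ∷ K ∷ [])) (solve (F₀ ∷ F₁ ∷ F₂ ∷ K ∷ []))
    open ≡-Reasoning
    φ^ℓ[1+kψ^ℓ] : φ^ suc j * (ι 1ℤ ⊕ + k · ψ^ suc j) ≡ -1ℤ · ψ^ suc j ⊕ ι (+ lucas (suc j) - + k)
    φ^ℓ[1+kψ^ℓ] = begin
      φ^ suc j * (ι 1ℤ ⊕ + k · ψ^ suc j)             ≡⟨ φ^-⊕ (suc j) _ _ ⟩
      φ^ suc j * ι 1ℤ ⊕ φ^ suc j * (+ k · ψ^ suc j)  ≡⟨ cong (φ^ suc j * ι 1ℤ ⊕_) (φ^-· (suc j) (+ k) _) ⟩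
      φ^ suc j * ι 1ℤ ⊕ + k · (φ^ suc j * ψ^ suc j)  ≡⟨ cong₂ (λ u v → u ⊕ + k · v) (φ^*1≡fib j) (φ^ℓ*ψ^ℓ even) ⟩
      (+ fib j +φ + fib (suc j)) ⊕ + k · ι -1ℤ       ≡⟨ rearrange (+ fib j) (+ fib (suc j)) (+ fib (suc (suc j))) (+ k) ⟩
      -1ℤ · ψ^ suc j ⊕ ι (+ lucas (suc j) - + k)     ∎

  Positive-φ⁻¹-kψ^ℓ : ∀ {j} → Even j → ∀ k → Positive (φ⁻¹ ⊕ - + k · ψ^ suc j)
  Positive-φ⁻¹-kψ^ℓ {j} even k = Positive-φ^⁻ (suc j) (subst Positive (sym φ^ℓ[φ⁻¹-kψ^ℓ])
    (Positive-⊕-Nonneg (Positive-φ^ j Positive-1) (nonneg (+≤+ z≤n) ≤-refl)))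
    where
    negate : ∀ K → - K · ι -1ℤ ≡ ι K
    negate K = cong₂ _+φ_ (solve (K ∷ [])) (solve (K ∷ []))
    open ≡-Reasoning
    φ^ℓ[φ⁻¹-kψ^ℓ] : φ^ suc j * (φ⁻¹ ⊕ - + k · ψ^ suc j) ≡ φ^ j * ι 1ℤ ⊕ ι (+ k)
    φ^ℓ[φ⁻¹-kψ^ℓ] = begin
      φ^ suc j * (φ⁻¹ ⊕ - + k · ψ^ suc j)               ≡⟨ φ^-⊕ (suc j) _ _ ⟩
      φ^ suc j * φ⁻¹ ⊕ φ^ suc j * (- + k · ψ^ suc j)    ≡⟨ cong₂ _⊕_ (sym (φ^-φ* j φ⁻¹)) (φ^-· (suc j) (- + k) _) ⟩
      φ^ j * ι 1ℤ ⊕ - + k · (φ^ suc j * ψ^ suc j)       ≡⟨ cong (λ v → φ^ j * ι 1ℤ ⊕ - + k · v) (φ^ℓ*ψ^ℓ even) ⟩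
      φ^ j * ι 1ℤ ⊕ - + k · ι -1ℤ                       ≡⟨ cong (φ^ j * ι 1ℤ ⊕_) (negate (+ k)) ⟩
      φ^ j * ι 1ℤ ⊕ ι (+ k)                             ∎

  fib-pair-⌊/φ⌋ : ∀ {j k} → Even j → k <φ^ suc j →
                  + (k ℕ.* fib (suc j)) ≡⌊ 1ℤ + + (k ℕ.* fib (suc (suc j))) /φ⌋
  fib-pair-⌊/φ⌋ {j} {k} even k<φ^ℓ =
    subst₂ _≡⌊_/φ⌋ (sym (pos-* k _)) (cong (λ x → 1ℤ + x) (sym (pos-* k _)))
      (⌊/φ⌋-intro {+ k} {+ fib (suc j)} {+ fib (suc (suc j))}
        (Positive-1+kψ^ℓ even (<φ^⇒≤lucas {k = k} even k<φ^ℓ)) (Positive-φ⁻¹-kψ^ℓ even k))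

open GoldenIntegers using (⌊/φ⌋⇒G≡; fib-pair-⌊/φ⌋)

open import Data.Nat using (_+_; _*_; _<_)
open import Data.Product using (∃)

lemma1 : (ℓ′ k : ℕ) → ∃ (λ m → ℓ′ ≡ 1 + 2 * m) → 0 < k → k <φ^ ℓ′ →
           G (k * fib (suc ℓ′)) ≡ k * fib ℓ′
lemma1 _ k (m , refl) _ k<φ^ℓ′ = ⌊/φ⌋⇒G≡ (fib-pair-⌊/φ⌋ {k = k} (even-2* m) k<φ^ℓ′)
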